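{- Let $E_n$ ($n\ge 1$) be the Bethe cacti defined below. Then $M(E_1;x,y)=2xy^2$, $M(E_2;x,y)=6x^2y^2+4x^2y^3+2x^2y^4+2x^3y^4$, and for every $n\ge 3$, $$M(E_n;x,y)=2\cdot 3^{n-1}x^2y^2+2\cdot 3^{n-1}x^2y^4+6x^3y^4+(2\cdot 3^{n-1}-10)x^4y^4 .$$
   Context: For a finite simple graph $G$ and integers $i,j\ge 1$, let $m_{i,j}(G)$ be the number of edges $uv$ of $G$ with $\{d_u(G),d_v(G)\}=\{i,j\}$, where $d_v(G)$ is the degree of $v$. The $M$-polynomial of $G$ is $M(G;x,y)=\sum_{i\le j} m_{i,j}(G)\,x^iy^j$. Rooted Bethe cacti $D_n$: $D_1$ is a $4$-cycle with one designated vertex, its root. For $n\ge 2$, take a $4$-cycle with vertices $a,b,c,d$ in cyclic order, declare $a$ the root of $D_n$, and take three disjoint copies of $D_{n-1}$, identifying their roots with $b$, $c$, $d$ respectively. Bethe cacti $E_n$: $E_1$ is the path on three vertices. For $n\ge 2$, $E_n$ is obtained from a path on three vertices by taking three disjoint copies of $D_{n-1}$ and identifying the root of each copy with a different vertex of the path. -}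

module Defs where

open import Data.Nat using (ℕ; zero; suc; _+_; _*_; _∸_; _≡ᵇ_; _≤ᵇ_)
open import Data.Bool using (Bool; true; false; _∧_; _∨_; not; if_then_else_)
open import Data.List using (List; []; _∷_; _++_; map; upTo; concatMap)
open import Data.Bool.ListAction using (any)
open import Data.Product using (_×_; _,_)
open import Relation.Binary.PropositionalEquality using (_≡_)

-- A graph has vertex set {0, …, size-1} and is given by a list of
-- edges.  Adjacency is symmetric and irreflexive (so the graph is
-- simple); repeated edges in the list do not matter.

record Graph : Set where
  constructor graph
  field
    size  : ℕ
    edges : List (ℕ × ℕ)

open Graph public

count : {A : Set} → (A → Bool) → List A → ℕ
count p []       = 0
count p (x ∷ xs) = if p x then suc (count p xs) else count p xs

adj : Graph → ℕ → ℕ → Bool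
adj G u v = not (u ≡ᵇ v) ∧ any hit (edges G)
  where
  hit : ℕ × ℕ → Bool
  hit (a , b) = ((a ≡ᵇ u) ∧ (b ≡ᵇ v)) ∨ ((a ≡ᵇ v) ∧ (b ≡ᵇ u))

deg : Graph → ℕ → ℕ
deg G v = count (λ u → adj G u v) (upTo (size G))

vertexPairs : Graph → List (ℕ × ℕ)
vertexPairs G = concatMap (λ v → map (λ u → (u , v)) (upTo v)) (upTo (size G))

m : Graph → ℕ → ℕ → ℕ
m G i j = count ok (vertexPairs G)
  where
  ok : ℕ × ℕ → Bool
  ok (u , v) = adj G u v ∧
    (((deg G u ≡ᵇ i) ∧ (deg G v ≡ᵇ j)) ∨ ((deg G u ≡ᵇ j) ∧ (deg G v ≡ᵇ i)))

-- The M-polynomial M(G;x,y) = Σ_{i ≤ j} m_{i,j}(G) x^i y^j, given by its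
-- coefficient function: MPoly G i j is the coefficient of x^i y^j.
MPoly : Graph → ℕ → ℕ → ℕ
MPoly G i j = if i ≤ᵇ j then m G i j else 0

-- Polynomials in x, y with natural coefficients, written as lists of
-- monomials (c , i , j) meaning c·x^i·y^j; coeff P i j is the
-- coefficient of x^i y^j.

Poly : Set
Poly = List (ℕ × ℕ × ℕ)

coeff : Poly → ℕ → ℕ → ℕ
coeff []                  i j = 0
coeff ((c , a , b) ∷ ps)  i j =
  (if (a ≡ᵇ i) ∧ (b ≡ᵇ j) then c else 0) + coeff ps i j

_hasMPoly_ : Graph → Poly → Set
G hasMPoly P = ∀ i j → MPoly G i j ≡ coeff P i j

-- Gluing: a copy of a rooted graph H (root = vertex 0) whose root is
-- identified with vertex t, the other vertices k (1 ≤ k) being renamed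
-- o + k.

relabel : ℕ → ℕ → ℕ → ℕ
relabel t o v = if v ≡ᵇ 0 then t else o + v

copyAt : Graph → ℕ → ℕ → List (ℕ × ℕ)
copyAt H t o = map (λ { (a , b) → (relabel t o a , relabel t o b) }) (edges H)

cycle4 : List (ℕ × ℕ)
cycle4 = (0 , 1) ∷ (1 , 2) ∷ (2 , 3) ∷ (3 , 0) ∷ []

path3 : List (ℕ × ℕ)
path3 = (0 , 1) ∷ (1 , 2) ∷ []

-- one gluing step: 4-cycle a=0,b=1,c=2,d=3 (root a) with three copies
-- of the rooted graph H attached at b, c, d
stepD : Graph → Graph
stepD H =
  graph (4 + 3 * (s ∸ 1))
        (cycle4 ++ copyAt H 1 3 ++ copyAt H 2 (3 + (s ∸ 1))
                ++ copyAt H 3 (3 + 2 * (s ∸ 1)))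
  where
  s = size H

stepE : Graph → Graph
stepE H =
  graph (3 + 3 * (s ∸ 1))
        (path3 ++ copyAt H 0 2 ++ copyAt H 1 (2 + (s ∸ 1))
               ++ copyAt H 2 (2 + 2 * (s ∸ 1)))
  where
  s = size H

-- Rooted Bethe cacti D_n (n ≥ 1), root = vertex 0.
-- (D 0 is an unused dummy value.)
D : ℕ → Graph
D zero          = graph 4 cycle4
D (suc zero)    = graph 4 cycle4
D (suc (suc n)) = stepD (D (suc n))

-- Bethe cacti E_n (n ≥ 1).  (E 0 is an unused dummy value.)
E : ℕ → Graph
E zero          = graph 3 path3
E (suc zero)    = graph 3 path3
E (suc (suc n)) = stepE (D (suc n))

module Submission where

-- For i ≤ j, m_{i,j}(G) counts the edges whose degree pair, sorted, is
-- (i , j); so everything is decided by the list of degree pairs of the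
-- edges.  Both D_{k+1} ↦ D_{k+2} and D_{k+1} ↦ E_{k+2} glue three copies
--    of a rooted graph onto a base (a 4-cycle or a path).  The glued edge
--    list is again simple, and its degree pairs are those of the base
--    followed by those of the copies, where a copy's root takes the degree
--    of its attachment vertex.  Weighting each pair by the indicator of its sorted form, the
--    weights of cactusPairs obey a closed form with a factor 3^k, and a
--    short computation gives the three coefficient lists of the theorem.

open import Defs
open import Data.Nat using (ℕ; zero; suc; _+_; _*_; _∸_; _^_; _≡ᵇ_; _<ᵇ_; _≤ᵇ_; _≤_; _<_; _>_; z≤n; s≤s; z<s; _⊓_; _⊔_)
open import Data.Nat.Properties
open import Data.Nat.Tactic.RingSolver using (solve-∀)
open import Data.Bool using (Bool; true; false; _∧_; _∨_; not; if_then_else_; T)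
open import Data.Bool.Properties using (T-∧; T-∨; ∧-distribˡ-∨; ∧-distribʳ-∨; ∧-zeroʳ; ∧-identityʳ; ∧-comm; ∨-comm)
open import Data.Bool.ListAction using (any; or)
open import Data.List using (List; []; _∷_; _++_; map; upTo; concat)
open import Data.Nat.ListAction using (sum)
open import Data.Nat.ListAction.Properties using (sum-++)
open import Data.List.Properties using (upTo-∷ʳ; map-++; concat-++; ++-identityʳ; map-∘; map-cong; map-cong-local)
open import Data.List.Relation.Unary.All as All using (All; []; _∷_)
import Data.List.Relation.Unary.All.Properties as AllP
open import Data.List.Relation.Unary.AllPairs as AllPairs using (AllPairs; []; _∷_)
import Data.List.Relation.Unary.AllPairs.Properties as AllPairsP
open import Data.Product using (_×_; _,_; proj₁; proj₂)
open import Data.Sum using (_⊎_; inj₁; inj₂)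
open import Data.Empty using (⊥; ⊥-elim)
open import Function using (_∘_)
open import Function.Bundles using (Equivalence)
open import Relation.Nullary using (¬_; yes; no)
open import Relation.Binary.Definitions using (Tri; tri<; tri≈; tri>)
open import Relation.Binary.PropositionalEquality

bit : Bool → ℕ
bit true  = 1
bit false = 0

if-suc : ∀ b n → (if b then suc n else n) ≡ bit b + n
if-suc true  n = refl
if-suc false n = refl

≡ᵇ-refl : ∀ n → (n ≡ᵇ n) ≡ true
≡ᵇ-refl zero    = refl
≡ᵇ-refl (suc n) = ≡ᵇ-refl n

≢⇒≡ᵇ-false : ∀ {m n} → m ≢ n → (m ≡ᵇ n) ≡ false
≢⇒≡ᵇ-false {m} {n} m≢n with m ≡ᵇ n in eq
... | true  = ⊥-elim (m≢n (≡ᵇ⇒≡ m n (subst T (sym eq) _)))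
... | false = refl

≡ᵇ-sym : ∀ m n → (m ≡ᵇ n) ≡ (n ≡ᵇ m)
≡ᵇ-sym zero    zero    = refl
≡ᵇ-sym zero    (suc n) = refl
≡ᵇ-sym (suc m) zero    = refl
≡ᵇ-sym (suc m) (suc n) = ≡ᵇ-sym m n

≡ᵇ-to : ∀ {m n} → T (m ≡ᵇ n) → m ≡ n
≡ᵇ-to {m} {n} = ≡ᵇ⇒≡ m n

≡ᵇ-from : ∀ {m n} → m ≡ n → T (m ≡ᵇ n)
≡ᵇ-from {m} {n} = ≡⇒≡ᵇ m n

T-false : ∀ {b} → b ≡ false → ¬ T b
T-false refl ()

T-ext : ∀ {x y} → (T x → T y) → (T y → T x) → x ≡ y
T-ext {true}  {true}  _ _ = refl
T-ext {true}  {false} f _ = ⊥-elim (f _)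
T-ext {false} {true}  _ g = ⊥-elim (g _)
T-ext {false} {false} _ _ = refl

∧-elim : ∀ {x y} → T (x ∧ y) → T x × T y
∧-elim = Equivalence.to T-∧

∧-intro : ∀ {x y} → T x → T y → T (x ∧ y)
∧-intro tx ty = Equivalence.from T-∧ (tx , ty)

∨-elim : ∀ {x y} → T (x ∨ y) → T x ⊎ T y
∨-elim = Equivalence.to T-∨

∨-introˡ : ∀ {x y} → T x → T (x ∨ y)
∨-introˡ tx = Equivalence.from T-∨ (inj₁ tx)

∨-introʳ : ∀ {x y} → T y → T (x ∨ y)
∨-introʳ ty = Equivalence.from T-∨ (inj₂ ty)

module _ {A : Set} where

  count-++ : ∀ (p : A → Bool) xs ys → count p (xs ++ ys) ≡ count p xs + count p ys
  count-++ p []       ys = refl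
  count-++ p (x ∷ xs) ys with p x
  ... | true  = cong suc (count-++ p xs ys)
  ... | false = count-++ p xs ys

  count-map : ∀ {B : Set} (p : B → Bool) (f : A → B) xs →
              count p (map f xs) ≡ count (λ x → p (f x)) xs
  count-map p f []       = refl
  count-map p f (x ∷ xs) with p (f x)
  ... | true  = cong suc (count-map p f xs)
  ... | false = count-map p f xs

  count-cong-All : ∀ {p q : A → Bool} xs → All (λ x → p x ≡ q x) xs → count p xs ≡ count q xs
  count-cong-All []       []       = refl
  count-cong-All {p} {q} (x ∷ xs) (e ∷ es) rewrite e with q x
  ... | true  = cong suc (count-cong-All xs es)
  ... | false = count-cong-All xs es

  count-cong : ∀ {p q : A → Bool} xs → (∀ x → p x ≡ q x) → count p xs ≡ count q xs
  count-cong xs p≗q = count-cong-All xs (All.universal p≗q xs)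

  count-none : ∀ xs → count (λ (_ : A) → false) xs ≡ 0
  count-none []       = refl
  count-none (x ∷ xs) = count-none xs

  count-∨ : ∀ (p q : A → Bool) xs → (∀ x → T (p x) → ¬ T (q x)) →
            count (λ x → p x ∨ q x) xs ≡ count p xs + count q xs
  count-∨ p q []       excl = refl
  count-∨ p q (x ∷ xs) excl with p x in px | q x in qx
  ... | true  | true  = ⊥-elim (excl x (subst T (sym px) _) (subst T (sym qx) _))
  ... | true  | false = cong suc (count-∨ p q xs excl)
  ... | false | true  = trans (cong suc (count-∨ p q xs excl)) (sym (+-suc _ _))
  ... | false | false = count-∨ p q xs excl

count-upTo-suc : ∀ (p : ℕ → Bool) n → count p (upTo (suc n)) ≡ count p (upTo n) + bit (p n)
count-upTo-suc p n = begin
  count p (upTo (suc n))               ≡⟨ cong (count p) (sym (upTo-∷ʳ n)) ⟩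
  count p (upTo n ++ n ∷ [])           ≡⟨ count-++ p (upTo n) (n ∷ []) ⟩
  count p (upTo n) + count p (n ∷ [])  ≡⟨ cong (count p (upTo n) +_) (trans (if-suc (p n) 0) (+-identityʳ _)) ⟩
  count p (upTo n) + bit (p n)         ∎
  where open ≡-Reasoning

count-index-absent : ∀ w n → n ≤ w → count (_≡ᵇ w) (upTo n) ≡ 0
count-index-absent w zero    _   = refl
count-index-absent w (suc n) n<w = begin
  count (_≡ᵇ w) (upTo (suc n))             ≡⟨ count-upTo-suc (_≡ᵇ w) n ⟩
  count (_≡ᵇ w) (upTo n) + bit (n ≡ᵇ w)    ≡⟨ cong₂ _+_ (count-index-absent w n (<⇒≤ n<w)) (cong bit (≢⇒≡ᵇ-false (<⇒≢ n<w))) ⟩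
  0                                        ∎
  where open ≡-Reasoning

count-index-present : ∀ w n → w < n → count (_≡ᵇ w) (upTo n) ≡ 1
count-index-present w (suc n) w<1+n with m<1+n⇒m<n∨m≡n w<1+n
... | inj₁ w<n = trans (count-upTo-suc (_≡ᵇ w) n)
                       (cong₂ _+_ (count-index-present w n w<n) (cong bit (≢⇒≡ᵇ-false (≢-sym (<⇒≢ w<n)))))
... | inj₂ refl = trans (count-upTo-suc (_≡ᵇ w) w)
                        (cong₂ _+_ (count-index-absent w w ≤-refl) (cong bit (≡ᵇ-refl w)))

Edge : Set
Edge = ℕ × ℕ

pairs : ℕ → List Edge
pairs n = concat (map (λ v → map (λ u → (u , v)) (upTo v)) (upTo n))

pairs-suc : ∀ n → pairs (suc n) ≡ pairs n ++ map (λ u → (u , n)) (upTo n)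
pairs-suc n = begin
  concat (map row (upTo (suc n)))        ≡⟨ cong (concat ∘ map row) (sym (upTo-∷ʳ n)) ⟩
  concat (map row (upTo n ++ n ∷ []))    ≡⟨ cong concat (map-++ row (upTo n) (n ∷ [])) ⟩
  concat (map row (upTo n) ++ row n ∷ [])  ≡⟨ sym (concat-++ (map row (upTo n)) (row n ∷ [])) ⟩
  pairs n ++ row n ++ []                 ≡⟨ cong (pairs n ++_) (++-identityʳ (row n)) ⟩
  pairs n ++ row n                       ∎
  where
  open ≡-Reasoning
  row : ℕ → List Edge
  row v = map (λ u → (u , v)) (upTo v)

count-pairs-suc : ∀ (p : Edge → Bool) n →
                  count p (pairs (suc n)) ≡ count p (pairs n) + count (λ u → p (u , n)) (upTo n)
count-pairs-suc p n = begin
  count p (pairs (suc n))                                     ≡⟨ cong (count p) (pairs-suc n) ⟩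
  count p (pairs n ++ map (λ u → (u , n)) (upTo n))           ≡⟨ count-++ p (pairs n) _ ⟩
  count p (pairs n) + count p (map (λ u → (u , n)) (upTo n))  ≡⟨ cong (count p (pairs n) +_) (count-map p _ (upTo n)) ⟩
  count p (pairs n) + count (λ u → p (u , n)) (upTo n)        ∎
  where open ≡-Reasoning

isPair : ℕ → ℕ → Edge → Bool
isPair a b (u , v) = (u ≡ᵇ a) ∧ (v ≡ᵇ b)

count-isPair-early : ∀ a b n → n ≤ b → count (isPair a b) (pairs n) ≡ 0
count-isPair-early a b zero    _   = refl
count-isPair-early a b (suc n) n<b = begin
  count (isPair a b) (pairs (suc n))                                ≡⟨ count-pairs-suc (isPair a b) n ⟩
  count (isPair a b) (pairs n) + count (λ u → isPair a b (u , n)) (upTo n)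
    ≡⟨ cong₂ _+_ (count-isPair-early a b n (<⇒≤ n<b)) (count-cong (upTo n) second-differs) ⟩
  count (λ _ → false) (upTo n)                                      ≡⟨ count-none (upTo n) ⟩
  0                                                                 ∎
  where
  open ≡-Reasoning
  second-differs : ∀ u → isPair a b (u , n) ≡ false
  second-differs u = trans (cong ((u ≡ᵇ a) ∧_) (≢⇒≡ᵇ-false (<⇒≢ n<b))) (∧-zeroʳ _)

count-isPair : ∀ a b n → b < n → count (isPair a b) (pairs n) ≡ count (_≡ᵇ a) (upTo b)
count-isPair a b (suc n) b<1+n with m<1+n⇒m<n∨m≡n b<1+n
... | inj₁ b<n = begin
  count (isPair a b) (pairs (suc n))         ≡⟨ count-pairs-suc (isPair a b) n ⟩
  count (isPair a b) (pairs n) + count (λ u → isPair a b (u , n)) (upTo n)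
    ≡⟨ cong₂ _+_ (count-isPair a b n b<n) (count-cong (upTo n) second-differs) ⟩
  count (_≡ᵇ a) (upTo b) + count (λ _ → false) (upTo n)
    ≡⟨ trans (cong (count (_≡ᵇ a) (upTo b) +_) (count-none (upTo n))) (+-identityʳ _) ⟩
  count (_≡ᵇ a) (upTo b)                     ∎
  where
  open ≡-Reasoning
  second-differs : ∀ u → isPair a b (u , n) ≡ false
  second-differs u = trans (cong ((u ≡ᵇ a) ∧_) (≢⇒≡ᵇ-false (≢-sym (<⇒≢ b<n)))) (∧-zeroʳ _)
... | inj₂ refl = begin
  count (isPair a b) (pairs (suc b))         ≡⟨ count-pairs-suc (isPair a b) b ⟩
  count (isPair a b) (pairs b) + count (λ u → isPair a b (u , b)) (upTo b)
    ≡⟨ cong₂ _+_ (count-isPair-early a b b ≤-refl) (count-cong (upTo b) second-matches) ⟩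
  count (_≡ᵇ a) (upTo b)                     ∎
  where
  open ≡-Reasoning
  second-matches : ∀ u → isPair a b (u , b) ≡ (u ≡ᵇ a)
  second-matches u = trans (cong ((u ≡ᵇ a) ∧_) (≡ᵇ-refl b)) (∧-identityʳ _)

joins : ℕ → ℕ → Edge → Bool
joins u v (a , b) = ((a ≡ᵇ u) ∧ (b ≡ᵇ v)) ∨ ((a ≡ᵇ v) ∧ (b ≡ᵇ u))

adjIn : List Edge → ℕ → ℕ → Bool
adjIn es u v = not (u ≡ᵇ v) ∧ any (joins u v) es

incident : ℕ → Edge → Bool
incident v (a , b) = (a ≡ᵇ v) ∨ (b ≡ᵇ v)

degIn : List Edge → ℕ → ℕ
degIn es v = count (incident v) es

Valid : ℕ → Edge → Set
Valid n (a , b) = (a ≡ᵇ b) ≡ false × a < n × b < n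

Distinct : Edge → Edge → Set
Distinct e f = joins (proj₁ f) (proj₂ f) e ≡ false

Simple : ℕ → List Edge → Set
Simple n es = All (Valid n) es × AllPairs Distinct es

joins-endpoints : ∀ {u v a b} → T (joins u v (a , b)) → (a ≡ u × b ≡ v) ⊎ (a ≡ v × b ≡ u)
joins-endpoints {u} {v} {a} {b} t with ∨-elim {(a ≡ᵇ u) ∧ (b ≡ᵇ v)} t
... | inj₁ t₁ = inj₁ (≡ᵇ-to (proj₁ (∧-elim t₁)) , ≡ᵇ-to (proj₂ (∧-elim {a ≡ᵇ u} t₁)))
... | inj₂ t₂ = inj₂ (≡ᵇ-to (proj₁ (∧-elim t₂)) , ≡ᵇ-to (proj₂ (∧-elim {a ≡ᵇ v} t₂)))

joins-self : ∀ a b → T (joins a b (a , b))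
joins-self a b = ∨-introˡ (∧-intro (≡ᵇ-from {a} refl) (≡ᵇ-from {b} refl))

joins-swap : ∀ a b → T (joins b a (a , b))
joins-swap a b = ∨-introʳ {(a ≡ᵇ b) ∧ (b ≡ᵇ a)} (∧-intro (≡ᵇ-from {a} refl) (≡ᵇ-from {b} refl))

joins-same : ∀ {u v} e f → T (joins u v e) → T (joins u v f) → T (joins (proj₁ f) (proj₂ f) e)
joins-same {u} {v} (a , b) (c , d) t s with joins-endpoints {u} {v} {a} {b} t | joins-endpoints {u} {v} {c} {d} s
... | inj₁ (refl , refl) | inj₁ (refl , refl) = joins-self a b
... | inj₁ (refl , refl) | inj₂ (refl , refl) = joins-swap a b
... | inj₂ (refl , refl) | inj₁ (refl , refl) = joins-swap a b
... | inj₂ (refl , refl) | inj₂ (refl , refl) = joins-self a b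

joined-once : ∀ {u v} e es → All (Distinct e) es → T (joins u v e) → ¬ T (any (joins u v) es)
joined-once e (f ∷ es) (e≠f ∷ e≠es) t s with ∨-elim {joins _ _ f} s
... | inj₁ s₁ = T-false e≠f (joins-same e f t s₁)
... | inj₂ s₂ = joined-once e es e≠es t s₂

isPair-to : ∀ {a b u v} → T (isPair a b (u , v)) → u ≡ a × v ≡ b
isPair-to {u = u} s = ≡ᵇ-to (proj₁ (∧-elim s)) , ≡ᵇ-to (proj₂ (∧-elim {u ≡ᵇ _} s))

joins-as-pairs : ∀ {a b} → (a ≡ᵇ b) ≡ false → ∀ u v →
                 (not (u ≡ᵇ v) ∧ joins u v (a , b)) ≡ (isPair a b (u , v) ∨ isPair b a (u , v))
joins-as-pairs {a} {b} a≢b u v = T-ext to from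
  where
  b≢a : (b ≡ᵇ a) ≡ false
  b≢a = trans (≡ᵇ-sym b a) a≢b
  not-true : ∀ {x} → x ≡ false → T (not x)
  not-true refl = _
  to : T (not (u ≡ᵇ v) ∧ joins u v (a , b)) → T (isPair a b (u , v) ∨ isPair b a (u , v))
  to t with joins-endpoints {u} {v} {a} {b} (proj₂ (∧-elim {not (u ≡ᵇ v)} t))
  ... | inj₁ (refl , refl) = ∨-introˡ (∧-intro (≡ᵇ-from {a} refl) (≡ᵇ-from {b} refl))
  ... | inj₂ (refl , refl) = ∨-introʳ {isPair a b (b , a)} (∧-intro (≡ᵇ-from {b} refl) (≡ᵇ-from {a} refl))
  from : T (isPair a b (u , v) ∨ isPair b a (u , v)) → T (not (u ≡ᵇ v) ∧ joins u v (a , b))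
  from s with ∨-elim {isPair a b (u , v)} s
  ... | inj₁ s₁ with isPair-to {a} {b} {u} {v} s₁
  ...   | refl , refl = ∧-intro (not-true a≢b) (joins-self a b)
  from s | inj₂ s₂ with isPair-to {b} {a} {u} {v} s₂
  ...   | refl , refl = ∧-intro (not-true b≢a) (joins-swap a b)

isPair-exclusive : ∀ {a b} → (a ≡ᵇ b) ≡ false → ∀ p → T (isPair a b p) → ¬ T (isPair b a p)
isPair-exclusive {a} {b} a≢b (u , v) s t =
  T-false a≢b (≡ᵇ-from (trans (sym (proj₁ (isPair-to {a} {b} {u} {v} s))) (proj₁ (isPair-to {b} {a} {u} {v} t))))

count-∧-const : ∀ {A : Set} (p : A → Bool) c xs → count (λ x → p x ∧ c) xs ≡ bit c * count p xs
count-∧-const p true  xs = trans (count-cong xs (λ x → ∧-identityʳ (p x))) (sym (+-identityʳ _))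
count-∧-const p false xs = trans (count-cong xs (λ x → ∧-zeroʳ (p x))) (count-none xs)

bit-∨ : ∀ {x y} → ¬ (T x × T y) → bit (x ∨ y) ≡ bit x + bit y
bit-∨ {true}  {true}  excl = ⊥-elim (excl (_ , _))
bit-∨ {true}  {false} excl = refl
bit-∨ {false} {y}     excl = refl

count-incident-edge : ∀ n a b v → Valid n (a , b) →
  count (λ u → not (u ≡ᵇ v) ∧ joins u v (a , b)) (upTo n) ≡ bit (incident v (a , b))
count-incident-edge n a b v (a≢b , a<n , b<n) = begin
  count (λ u → not (u ≡ᵇ v) ∧ joins u v (a , b)) (upTo n)
    ≡⟨ count-cong (upTo n) (λ u → joins-as-pairs a≢b u v) ⟩
  count (λ u → isPair a b (u , v) ∨ isPair b a (u , v)) (upTo n)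
    ≡⟨ count-∨ _ _ (upTo n) (λ u → isPair-exclusive a≢b (u , v)) ⟩
  count (λ u → (u ≡ᵇ a) ∧ (v ≡ᵇ b)) (upTo n) + count (λ u → (u ≡ᵇ b) ∧ (v ≡ᵇ a)) (upTo n)
    ≡⟨ cong₂ _+_ (count-∧-const (_≡ᵇ a) (v ≡ᵇ b) (upTo n)) (count-∧-const (_≡ᵇ b) (v ≡ᵇ a) (upTo n)) ⟩
  bit (v ≡ᵇ b) * count (_≡ᵇ a) (upTo n) + bit (v ≡ᵇ a) * count (_≡ᵇ b) (upTo n)
    ≡⟨ cong₂ (λ x y → bit (v ≡ᵇ b) * x + bit (v ≡ᵇ a) * y) (count-index-present a n a<n) (count-index-present b n b<n) ⟩
  bit (v ≡ᵇ b) * 1 + bit (v ≡ᵇ a) * 1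
    ≡⟨ cong₂ _+_ (trans (*-identityʳ _) (cong bit (≡ᵇ-sym v b))) (trans (*-identityʳ _) (cong bit (≡ᵇ-sym v a))) ⟩
  bit (b ≡ᵇ v) + bit (a ≡ᵇ v)
    ≡⟨ +-comm (bit (b ≡ᵇ v)) _ ⟩
  bit (a ≡ᵇ v) + bit (b ≡ᵇ v)
    ≡⟨ sym (bit-∨ not-both) ⟩
  bit (incident v (a , b)) ∎
  where
  open ≡-Reasoning
  not-both : ¬ (T (a ≡ᵇ v) × T (b ≡ᵇ v))
  not-both (s , t) = T-false a≢b (≡ᵇ-from (trans (≡ᵇ-to {a} s) (sym (≡ᵇ-to {b} t))))

count-neighbours : ∀ n es → Simple n es → ∀ v → count (λ u → adjIn es u v) (upTo n) ≡ degIn es v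
count-neighbours n []       _ v =
  trans (count-cong (upTo n) (λ u → ∧-zeroʳ (not (u ≡ᵇ v)))) (count-none (upTo n))
count-neighbours n (e ∷ es) (valid-e ∷ valid-es , e≠es ∷ distinct-es) v = begin
  count (λ u → adjIn (e ∷ es) u v) (upTo n)
    ≡⟨ count-cong (upTo n) (λ u → ∧-distribˡ-∨ (not (u ≡ᵇ v)) (joins u v e) (any (joins u v) es)) ⟩
  count (λ u → (not (u ≡ᵇ v) ∧ joins u v e) ∨ adjIn es u v) (upTo n)
    ≡⟨ count-∨ _ _ (upTo n) exclusive ⟩
  count (λ u → not (u ≡ᵇ v) ∧ joins u v e) (upTo n) + count (λ u → adjIn es u v) (upTo n)
    ≡⟨ cong₂ _+_ (count-incident-edge n (proj₁ e) (proj₂ e) v valid-e) (count-neighbours n es (valid-es , distinct-es) v) ⟩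
  bit (incident v e) + degIn es v
    ≡⟨ sym (if-suc (incident v e) (degIn es v)) ⟩
  degIn (e ∷ es) v ∎
  where
  open ≡-Reasoning
  exclusive : ∀ u → T (not (u ≡ᵇ v) ∧ joins u v e) → ¬ T (adjIn es u v)
  exclusive u s t = joined-once e es e≠es (proj₂ (∧-elim {not (u ≡ᵇ v)} s)) (proj₂ (∧-elim {not (u ≡ᵇ v)} t))

-- An edge (a , b) is found exactly once among the vertex pairs u < v, and
-- every symmetric condition Q is then tested on it once.
module _ (Q : Edge → Bool) (Q-sym : ∀ u v → Q (u , v) ≡ Q (v , u)) where

  private
    isPair-∧ : ∀ a b p → (isPair a b p ∧ Q p) ≡ (isPair a b p ∧ Q (a , b))
    isPair-∧ a b (u , v) = T-ext to from
      where
      to : T (isPair a b (u , v) ∧ Q (u , v)) → T (isPair a b (u , v) ∧ Q (a , b))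
      to t with isPair-to {a} {b} {u} {v} (proj₁ (∧-elim {isPair a b (u , v)} t))
      ... | refl , refl = t
      from : T (isPair a b (u , v) ∧ Q (a , b)) → T (isPair a b (u , v) ∧ Q (u , v))
      from t with isPair-to {a} {b} {u} {v} (proj₁ (∧-elim {isPair a b (u , v)} t))
      ... | refl , refl = t

  edge-test-as-pairs : ∀ {a b} → (a ≡ᵇ b) ≡ false → ∀ p →
    ((not (proj₁ p ≡ᵇ proj₂ p) ∧ joins (proj₁ p) (proj₂ p) (a , b)) ∧ Q p)
    ≡ ((isPair a b p ∧ Q (a , b)) ∨ (isPair b a p ∧ Q (b , a)))
  edge-test-as-pairs {a} {b} a≢b (u , v) = begin
    (not (u ≡ᵇ v) ∧ joins u v (a , b)) ∧ Q (u , v)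
      ≡⟨ cong (_∧ Q (u , v)) (joins-as-pairs a≢b u v) ⟩
    (isPair a b (u , v) ∨ isPair b a (u , v)) ∧ Q (u , v)
      ≡⟨ ∧-distribʳ-∨ (Q (u , v)) (isPair a b (u , v)) _ ⟩
    (isPair a b (u , v) ∧ Q (u , v)) ∨ (isPair b a (u , v) ∧ Q (u , v))
      ≡⟨ cong₂ _∨_ (isPair-∧ a b (u , v)) (isPair-∧ b a (u , v)) ⟩
    (isPair a b (u , v) ∧ Q (a , b)) ∨ (isPair b a (u , v) ∧ Q (b , a)) ∎
    where open ≡-Reasoning

  -- exactly one orientation of a ≠ b is a pair u < v, and Q agrees on both
  one-orientation : ∀ {a b} → (a ≡ᵇ b) ≡ false →
    bit (Q (a , b)) * count (_≡ᵇ a) (upTo b) + bit (Q (b , a)) * count (_≡ᵇ b) (upTo a) ≡ bit (Q (a , b))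
  one-orientation {a} {b} a≢b with <-cmp a b
  ... | tri< a<b _ _ rewrite count-index-present a b a<b | count-index-absent b a (<⇒≤ a<b) =
    trans (cong₂ _+_ (*-identityʳ _) (*-zeroʳ (bit (Q (b , a))))) (+-identityʳ _)
  ... | tri≈ _ refl _ = ⊥-elim (T-false a≢b (≡ᵇ-from {a} refl))
  ... | tri> _ _ b<a rewrite count-index-present b a b<a | count-index-absent a b (<⇒≤ b<a) =
    trans (cong₂ _+_ (*-zeroʳ (bit (Q (a , b)))) (*-identityʳ _)) (cong bit (Q-sym b a))

  count-edge-once : ∀ n a b → Valid n (a , b) →
    count (λ p → (not (proj₁ p ≡ᵇ proj₂ p) ∧ joins (proj₁ p) (proj₂ p) (a , b)) ∧ Q p) (pairs n) ≡ bit (Q (a , b))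
  count-edge-once n a b (a≢b , a<n , b<n) = begin
    count (λ p → (not (proj₁ p ≡ᵇ proj₂ p) ∧ joins (proj₁ p) (proj₂ p) (a , b)) ∧ Q p) (pairs n)
      ≡⟨ count-cong (pairs n) (edge-test-as-pairs a≢b) ⟩
    count (λ p → (isPair a b p ∧ Q (a , b)) ∨ (isPair b a p ∧ Q (b , a))) (pairs n)
      ≡⟨ count-∨ _ _ (pairs n) (λ p s t → isPair-exclusive a≢b p (proj₁ (∧-elim s)) (proj₁ (∧-elim t))) ⟩
    count (λ p → isPair a b p ∧ Q (a , b)) (pairs n) + count (λ p → isPair b a p ∧ Q (b , a)) (pairs n)
      ≡⟨ cong₂ _+_ (count-∧-const (isPair a b) _ (pairs n)) (count-∧-const (isPair b a) _ (pairs n)) ⟩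
    bit (Q (a , b)) * count (isPair a b) (pairs n) + bit (Q (b , a)) * count (isPair b a) (pairs n)
      ≡⟨ cong₂ (λ x y → bit (Q (a , b)) * x + bit (Q (b , a)) * y) (count-isPair a b n b<n) (count-isPair b a n a<n) ⟩
    bit (Q (a , b)) * count (_≡ᵇ a) (upTo b) + bit (Q (b , a)) * count (_≡ᵇ b) (upTo a)
      ≡⟨ one-orientation a≢b ⟩
    bit (Q (a , b)) ∎
    where open ≡-Reasoning

  count-adjacent-pairs : ∀ n es → Simple n es →
    count (λ p → adjIn es (proj₁ p) (proj₂ p) ∧ Q p) (pairs n) ≡ count Q es
  count-adjacent-pairs n [] _ =
    trans (count-cong (pairs n) (λ p → cong (_∧ Q p) (∧-zeroʳ (not (proj₁ p ≡ᵇ proj₂ p))))) (count-none (pairs n))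
  count-adjacent-pairs n (e ∷ es) (valid-e ∷ valid-es , e≠es ∷ distinct-es) = begin
    count (λ p → adjIn (e ∷ es) (proj₁ p) (proj₂ p) ∧ Q p) (pairs n)
      ≡⟨ count-cong (pairs n) split ⟩
    count (λ p → edgeHere p ∨ (adjIn es (proj₁ p) (proj₂ p) ∧ Q p)) (pairs n)
      ≡⟨ count-∨ _ _ (pairs n) exclusive ⟩
    count edgeHere (pairs n) + count (λ p → adjIn es (proj₁ p) (proj₂ p) ∧ Q p) (pairs n)
      ≡⟨ cong₂ _+_ (count-edge-once n (proj₁ e) (proj₂ e) valid-e) (count-adjacent-pairs n es (valid-es , distinct-es)) ⟩
    bit (Q e) + count Q es
      ≡⟨ sym (if-suc (Q e) (count Q es)) ⟩
    count Q (e ∷ es) ∎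
    where
    open ≡-Reasoning
    edgeHere : Edge → Bool
    edgeHere p = (not (proj₁ p ≡ᵇ proj₂ p) ∧ joins (proj₁ p) (proj₂ p) e) ∧ Q p
    split : ∀ p → (adjIn (e ∷ es) (proj₁ p) (proj₂ p) ∧ Q p) ≡ (edgeHere p ∨ (adjIn es (proj₁ p) (proj₂ p) ∧ Q p))
    split (u , v) = trans (cong (_∧ Q (u , v)) (∧-distribˡ-∨ (not (u ≡ᵇ v)) (joins u v e) (any (joins u v) es)))
                          (∧-distribʳ-∨ (Q (u , v)) (not (u ≡ᵇ v) ∧ joins u v e) _)
    exclusive : ∀ p → T (edgeHere p) → ¬ T (adjIn es (proj₁ p) (proj₂ p) ∧ Q p)
    exclusive (u , v) s t = joined-once e es e≠es
      (proj₂ (∧-elim {not (u ≡ᵇ v)} (proj₁ (∧-elim s)))) (proj₂ (∧-elim {not (u ≡ᵇ v)} (proj₁ (∧-elim t))))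

adj≡adjIn : ∀ G u v → adj G u v ≡ adjIn (edges G) u v
adj≡adjIn G u v = cong (λ hits → not (u ≡ᵇ v) ∧ or hits) (map-cong (λ { (a , b) → refl }) (edges G))

deg≡degIn : ∀ G → Simple (size G) (edges G) → ∀ v → deg G v ≡ degIn (edges G) v
deg≡degIn G simple v =
  trans (count-cong (upTo (size G)) (λ u → adj≡adjIn G u v)) (count-neighbours (size G) (edges G) simple v)

joins-flip : ∀ u v a b → joins u v (a , b) ≡ joins u v (b , a)
joins-flip u v a b = trans (∨-comm ((a ≡ᵇ u) ∧ (b ≡ᵇ v)) _) (cong₂ _∨_ (∧-comm (a ≡ᵇ v) _) (∧-comm (a ≡ᵇ u) _))

degreePairs : (ℕ → ℕ) → List Edge → List Edge
degreePairs d = map (λ e → d (proj₁ e) , d (proj₂ e))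

-- m_{i,j} counts the degree pairs of type {i , j}, i.e. those "joining" i and j
m≡count-types : ∀ G i j → Simple (size G) (edges G) →
  m G i j ≡ count (joins i j) (degreePairs (degIn (edges G)) (edges G))
m≡count-types G i j simple = begin
  m G i j
    ≡⟨ count-cong (pairs (size G)) (λ { (u , v) → cong (_∧ typed (u , v)) (adj≡adjIn G u v) }) ⟩
  count (λ p → adjIn (edges G) (proj₁ p) (proj₂ p) ∧ typed p) (pairs (size G))
    ≡⟨ count-adjacent-pairs typed (λ u v → joins-flip i j (deg G u) (deg G v)) (size G) (edges G) simple ⟩
  count typed (edges G)
    ≡⟨ count-cong (edges G) (λ e → cong₂ (λ x y → joins i j (x , y)) (deg≡degIn G simple (proj₁ e)) (deg≡degIn G simple (proj₂ e))) ⟩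
  count (λ e → joins i j (degIn (edges G) (proj₁ e) , degIn (edges G) (proj₂ e))) (edges G)
    ≡⟨ sym (count-map (joins i j) _ (edges G)) ⟩
  count (joins i j) (degreePairs (degIn (edges G)) (edges G)) ∎
  where
  open ≡-Reasoning
  typed : Edge → Bool
  typed p = joins i j (deg G (proj₁ p) , deg G (proj₂ p))

-- Disjoint blocks of edges.  The key of an edge is its larger endpoint;
-- equal edges have equal keys, so blocks with separated keys share no edge.

key : Edge → ℕ
key e = proj₁ e ⊔ proj₂ e

joins-key : ∀ {u v} e → T (joins u v e) → key e ≡ u ⊔ v
joins-key {u} {v} (a , b) t with joins-endpoints {u} {v} {a} {b} t
... | inj₁ (refl , refl) = refl
... | inj₂ (refl , refl) = ⊔-comm a b

separated : ∀ K xs ys → All (λ e → key e ≤ K) xs → All (λ f → K < key f) ys → All (λ e → All (Distinct e) ys) xs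
separated K xs ys below above = All.map (λ {e} e≤K → All.map (λ {f} K<f → distinct e f e≤K K<f) above) below
  where
  distinct : ∀ e f → key e ≤ K → K < key f → Distinct e f
  distinct e f e≤K K<f with joins (proj₁ f) (proj₂ f) e in eq
  ... | true  = ⊥-elim (<⇒≢ (≤-<-trans e≤K K<f) (joins-key e (subst T (sym eq) _)))
  ... | false = refl

valid-key : ∀ c e → Valid (suc c) e → key e ≤ c
valid-key c (a , b) (_ , a≤c , b≤c) = ⊔-lub (≤-pred a≤c) (≤-pred b≤c)

valid-mono : ∀ {m N} e → m ≤ N → Valid m e → Valid N e
valid-mono (a , b) m≤N (a≢b , a<m , b<m) = a≢b , <-≤-trans a<m m≤N , <-≤-trans b<m m≤N

degIn-beyond : ∀ m es x → All (Valid m) es → m ≤ x → degIn es x ≡ 0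
degIn-beyond m es x valid m≤x =
  trans (count-cong-All es (All.map (λ {e} → untouched e) valid)) (count-none es)
  where
  untouched : ∀ e → Valid m e → incident x e ≡ false
  untouched (a , b) (_ , a<m , b<m)
    rewrite ≢⇒≡ᵇ-false (<⇒≢ (<-≤-trans a<m m≤x)) | ≢⇒≡ᵇ-false (<⇒≢ (<-≤-trans b<m m≤x)) = refl

+-≡ᵇ : ∀ o a b → (o + a ≡ᵇ o + b) ≡ (a ≡ᵇ b)
+-≡ᵇ zero    a b = refl
+-≡ᵇ (suc o) a b = +-≡ᵇ o a b

rootedDeg : Graph → ℕ → ℕ → ℕ
rootedDeg H r x = if x ≡ᵇ 0 then r else degIn (edges H) x

rootedPairs : Graph → ℕ → List Edge
rootedPairs H r = degreePairs (rootedDeg H r) (edges H)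

module Copy (H : Graph) (valid : All (Valid (suc (size H ∸ 1))) (edges H)) (t o : ℕ) (t≤o : t ≤ o) where

  n : ℕ
  n = size H ∸ 1

  copy : List Edge
  copy = copyAt H t o

  rel : ℕ → ℕ
  rel = relabel t o

  o<rel-suc : ∀ a → o < rel (suc a)
  o<rel-suc a = m<m+n o z<s

  rel-≡ᵇ : ∀ x y → (rel x ≡ᵇ rel y) ≡ (x ≡ᵇ y)
  rel-≡ᵇ zero    zero    = ≡ᵇ-refl t
  rel-≡ᵇ zero    (suc y) = ≢⇒≡ᵇ-false (<⇒≢ (≤-<-trans t≤o (o<rel-suc y)))
  rel-≡ᵇ (suc x) zero    = ≢⇒≡ᵇ-false (≢-sym (<⇒≢ (≤-<-trans t≤o (o<rel-suc x))))
  rel-≡ᵇ (suc x) (suc y) = +-≡ᵇ o (suc x) (suc y)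

  rel-bound : ∀ a → a < suc n → rel a ≤ o + n
  rel-bound zero    _   = ≤-trans t≤o (m≤m+n o n)
  rel-bound (suc a) a<n = +-monoʳ-≤ o (≤-pred a<n)

  degIn-image : ∀ a → degIn copy (rel a) ≡ degIn (edges H) a
  degIn-image a = trans (count-map (incident (rel a)) _ (edges H))
    (count-cong (edges H) (λ { (x , y) → cong₂ _∨_ (rel-≡ᵇ x a) (rel-≡ᵇ y a) }))

  degIn-away : ∀ x → x ≢ t → x ≤ o ⊎ o + n < x → degIn copy x ≡ 0
  degIn-away x x≢t outside = trans (count-map (incident x) _ (edges H))
    (trans (count-cong-All (edges H) (All.map (λ {e} → untouched e) valid)) (count-none (edges H)))
    where
    differs : ∀ a → a < suc n → (rel a ≡ᵇ x) ≡ false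
    differs zero    _   = ≢⇒≡ᵇ-false (≢-sym x≢t)
    differs (suc a) a<n = ≢⇒≡ᵇ-false (side outside)
      where
      side : x ≤ o ⊎ o + n < x → rel (suc a) ≢ x
      side (inj₁ x≤o)   = ≢-sym (<⇒≢ (≤-<-trans x≤o (o<rel-suc a)))
      side (inj₂ o+n<x) = <⇒≢ (≤-<-trans (rel-bound (suc a) a<n) o+n<x)
    untouched : ∀ e → Valid (suc n) e → incident x (rel (proj₁ e) , rel (proj₂ e)) ≡ false
    untouched (a , b) (_ , a<n , b<n) rewrite differs a a<n | differs b b<n = refl

  degIn-below : ∀ x → x ≤ o → degIn copy x ≡ (if x ≡ᵇ t then degIn (edges H) 0 else 0)
  degIn-below x x≤o with x ≟ t
  ... | yes refl rewrite ≡ᵇ-refl x = degIn-image 0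
  ... | no x≢t   rewrite ≢⇒≡ᵇ-false x≢t = degIn-away x x≢t (inj₁ x≤o)

  pairs-copy : ∀ d → (∀ a → a < n → d (o + suc a) ≡ degIn (edges H) (suc a)) →
               degreePairs d copy ≡ rootedPairs H (d t)
  pairs-copy d image-deg = trans (sym (map-∘ (edges H))) (map-cong-local (All.map (λ {e} → same e) valid))
    where
    vertex : ∀ a → a < suc n → d (rel a) ≡ rootedDeg H (d t) a
    vertex zero    _   = refl
    vertex (suc a) a<n = image-deg a (≤-pred a<n)
    same : ∀ e → Valid (suc n) e →
           (d (rel (proj₁ e)) , d (rel (proj₂ e))) ≡ (rootedDeg H (d t) (proj₁ e) , rootedDeg H (d t) (proj₂ e))
    same (a , b) (_ , a<n , b<n) = cong₂ _,_ (vertex a a<n) (vertex b b<n)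

  valid-copy : ∀ N → o + n < N → All (Valid N) copy
  valid-copy N o+n<N = AllP.map⁺ (All.map (λ {e} → valid-image e) valid)
    where
    valid-image : ∀ e → Valid (suc n) e → Valid N (rel (proj₁ e) , rel (proj₂ e))
    valid-image (a , b) (a≢b , a<n , b<n) =
      trans (rel-≡ᵇ a b) a≢b , ≤-<-trans (rel-bound a a<n) o+n<N , ≤-<-trans (rel-bound b b<n) o+n<N

  keys-copy : All (λ e → o < key e × key e ≤ o + n) copy
  keys-copy = AllP.map⁺ (All.map (λ {e} → key-image e) valid)
    where
    key-image : ∀ e → Valid (suc n) e → o < key (rel (proj₁ e) , rel (proj₂ e)) × key (rel (proj₁ e) , rel (proj₂ e)) ≤ o + n
    key-image (zero  , zero ) (loop , _) = ⊥-elim (T-false loop _)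
    key-image (zero  , suc b) (_ , a<n , b<n) =
      <-≤-trans (o<rel-suc b) (m≤n⊔m t _) , ⊔-lub (rel-bound 0 a<n) (rel-bound (suc b) b<n)
    key-image (suc a , b)     (_ , a<n , b<n) =
      <-≤-trans (o<rel-suc a) (m≤m⊔n _ (rel b)) , ⊔-lub (rel-bound (suc a) a<n) (rel-bound b b<n)

  distinct-copy : AllPairs Distinct (edges H) → AllPairs Distinct copy
  distinct-copy distinct = AllPairsP.map⁺ (AllPairs.map (λ {e} {f} → distinct-image e f) distinct)
    where
    distinct-image : ∀ e f → Distinct e f → Distinct (rel (proj₁ e) , rel (proj₂ e)) (rel (proj₁ f) , rel (proj₂ f))
    distinct-image (a , b) (c , d) e≠f rewrite rel-≡ᵇ a c | rel-≡ᵇ b d | rel-≡ᵇ a d | rel-≡ᵇ b c = e≠f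

-- Both steps
-- of the Bethe cactus construction are instances by definition:
-- stepD H = glue3 3 cycle4 1 2 3 H and stepE H = glue3 2 path3 0 1 2 H.

glue3 : ℕ → List Edge → ℕ → ℕ → ℕ → Graph → Graph
glue3 c B t₁ t₂ t₃ H =
  graph (suc c + 3 * n) (B ++ copyAt H t₁ c ++ copyAt H t₂ (c + n) ++ copyAt H t₃ (c + 2 * n))
  where
  n : ℕ
  n = size H ∸ 1

module Glue (c : ℕ) (B : List Edge) (simple-B : Simple (suc c) B)
            (t₁ t₂ t₃ : ℕ) (t₁≤c : t₁ ≤ c) (t₂≤c : t₂ ≤ c) (t₃≤c : t₃ ≤ c)
            (H : Graph) (simple-H : Simple (suc (size H ∸ 1)) (edges H)) where

  n : ℕ
  n = size H ∸ 1

  G : Graph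
  G = glue3 c B t₁ t₂ t₃ H

  c≤o₂ : c ≤ c + n
  c≤o₂ = m≤m+n c n

  o₂+n≤o₃ : c + n + n ≤ c + 2 * n
  o₂+n≤o₃ = ≤-reflexive (lemma c n)
    where
    lemma : ∀ c n → c + n + n ≡ c + 2 * n
    lemma = solve-∀

  o₃+n<size : c + 2 * n + n < size G
  o₃+n<size = s≤s (≤-reflexive (lemma c n))
    where
    lemma : ∀ c n → c + 2 * n + n ≡ c + 3 * n
    lemma = solve-∀

  c≤o₃ : c ≤ c + 2 * n
  c≤o₃ = m≤m+n c (2 * n)

  o₂≤o₃ : c + n ≤ c + 2 * n
  o₂≤o₃ = ≤-trans (m≤m+n (c + n) n) o₂+n≤o₃

  o₂+n<size : c + n + n < size G
  o₂+n<size = ≤-<-trans o₂+n≤o₃ (≤-<-trans (m≤m+n _ n) o₃+n<size)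

  c+n<size : c + n < size G
  c+n<size = ≤-<-trans (m≤m+n _ n) o₂+n<size

  module C₁ = Copy H (proj₁ simple-H) t₁ c t₁≤c
  module C₂ = Copy H (proj₁ simple-H) t₂ (c + n) (≤-trans t₂≤c c≤o₂)
  module C₃ = Copy H (proj₁ simple-H) t₃ (c + 2 * n) (≤-trans t₃≤c c≤o₃)

  -- the glued edge list is simple: the blocks are simple and have separated keys
  simple : Simple (size G) (edges G)
  simple = valid , distinct
    where
    above : ∀ K o xs → K ≤ o → All (λ e → o < key e × key e ≤ o + n) xs → All (λ f → K < key f) xs
    above K o xs K≤o = All.map (λ bounds → ≤-<-trans K≤o (proj₁ bounds))
    below : ∀ o xs → All (λ e → o < key e × key e ≤ o + n) xs → All (λ e → key e ≤ o + n) xs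
    below o xs = All.map proj₂
    valid : All (Valid (size G)) (edges G)
    valid = AllP.++⁺ (All.map (λ {e} → valid-mono e (s≤s (m≤m+n c (3 * n)))) (proj₁ simple-B))
              (AllP.++⁺ (C₁.valid-copy _ c+n<size)
              (AllP.++⁺ (C₂.valid-copy _ o₂+n<size) (C₃.valid-copy _ o₃+n<size)))
    distinct : AllPairs Distinct (edges G)
    distinct =
      AllPairsP.++⁺ (proj₂ simple-B)
        (AllPairsP.++⁺ (C₁.distinct-copy (proj₂ simple-H))
          (AllPairsP.++⁺ (C₂.distinct-copy (proj₂ simple-H)) (C₃.distinct-copy (proj₂ simple-H))
            (separated (c + n + n) _ _ (below _ _ C₂.keys-copy) (above _ _ _ o₂+n≤o₃ C₃.keys-copy)))
          (separated (c + n) _ _ (below _ _ C₁.keys-copy)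
            (AllP.++⁺ (above _ _ _ ≤-refl C₂.keys-copy) (above _ _ _ o₂≤o₃ C₃.keys-copy))))
        (separated c _ _ (All.map (λ {e} → valid-key c e) (proj₁ simple-B))
          (AllP.++⁺ (above _ _ _ ≤-refl C₁.keys-copy)
            (AllP.++⁺ (above _ _ _ c≤o₂ C₂.keys-copy) (above _ _ _ c≤o₃ C₃.keys-copy))))

  degIn-parts : ∀ x → degIn (edges G) x ≡ degIn B x + (degIn C₁.copy x + (degIn C₂.copy x + degIn C₃.copy x))
  degIn-parts x = trans (count-++ (incident x) B _) (cong (degIn B x +_)
    (trans (count-++ (incident x) C₁.copy _) (cong (degIn C₁.copy x +_) (count-++ (incident x) C₂.copy _))))

  attach : ℕ → ℕ → ℕ
  attach t x = if x ≡ᵇ t then degIn (edges H) 0 else 0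

  degIn-base : ∀ x → x ≤ c → degIn (edges G) x ≡ degIn B x + (attach t₁ x + (attach t₂ x + attach t₃ x))
  degIn-base x x≤c = trans (degIn-parts x) (cong (degIn B x +_)
    (cong₂ _+_ (C₁.degIn-below x x≤c) (cong₂ _+_ (C₂.degIn-below x (≤-trans x≤c c≤o₂)) (C₃.degIn-below x (≤-trans x≤c c≤o₃)))))

  c<copy₂ : ∀ a → c < c + n + suc a
  c<copy₂ a = ≤-<-trans c≤o₂ (C₂.o<rel-suc a)

  c<copy₃ : ∀ a → c < c + 2 * n + suc a
  c<copy₃ a = ≤-<-trans c≤o₃ (C₃.o<rel-suc a)

  module _ (a : ℕ) (a<n : a < n) where

    private
      away : ∀ {t} x → t ≤ c → c < x → x ≢ t
      away x t≤c c<x x≡t = <⇒≢ (≤-<-trans t≤c c<x) (sym x≡t)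
      beyond-B : ∀ x → c < x → degIn B x ≡ 0
      beyond-B x c<x = degIn-beyond (suc c) B x (proj₁ simple-B) c<x

    degIn-copy₁ : degIn (edges G) (c + suc a) ≡ degIn (edges H) (suc a)
    degIn-copy₁
      rewrite degIn-parts (c + suc a) | beyond-B _ (C₁.o<rel-suc a) | C₁.degIn-image (suc a)
            | C₂.degIn-away _ (away _ t₂≤c (C₁.o<rel-suc a)) (inj₁ (+-monoʳ-≤ c a<n))
            | C₃.degIn-away _ (away _ t₃≤c (C₁.o<rel-suc a)) (inj₁ (≤-trans (+-monoʳ-≤ c a<n) o₂≤o₃))
      = +-identityʳ _

    degIn-copy₂ : degIn (edges G) (c + n + suc a) ≡ degIn (edges H) (suc a)
    degIn-copy₂
      rewrite degIn-parts (c + n + suc a) | beyond-B _ (c<copy₂ a) | C₂.degIn-image (suc a)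
            | C₁.degIn-away _ (away _ t₁≤c (c<copy₂ a)) (inj₂ (C₂.o<rel-suc a))
            | C₃.degIn-away _ (away _ t₃≤c (c<copy₂ a)) (inj₁ (≤-trans (+-monoʳ-≤ (c + n) a<n) o₂+n≤o₃))
      = +-identityʳ _

    degIn-copy₃ : degIn (edges G) (c + 2 * n + suc a) ≡ degIn (edges H) (suc a)
    degIn-copy₃
      rewrite degIn-parts (c + 2 * n + suc a) | beyond-B _ (c<copy₃ a) | C₃.degIn-image (suc a)
            | C₁.degIn-away _ (away _ t₁≤c (c<copy₃ a)) (inj₂ (≤-<-trans o₂≤o₃ (C₃.o<rel-suc a)))
            | C₂.degIn-away _ (away _ t₂≤c (c<copy₃ a)) (inj₂ (≤-<-trans o₂+n≤o₃ (C₃.o<rel-suc a)))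
      = refl

  glue-pairs : ∀ d → (∀ x → c < x → d x ≡ degIn (edges G) x) →
    degreePairs d (edges G) ≡ degreePairs d B ++ rootedPairs H (d t₁) ++ rootedPairs H (d t₂) ++ rootedPairs H (d t₃)
  glue-pairs d d-beyond =
    trans (map-++ _ B _) (cong (degreePairs d B ++_)
    (trans (map-++ _ C₁.copy _) (cong₂ _++_ (C₁.pairs-copy d (λ a a<n → trans (d-beyond _ (C₁.o<rel-suc a)) (degIn-copy₁ a a<n)))
    (trans (map-++ _ C₂.copy _) (cong₂ _++_ (C₂.pairs-copy d (λ a a<n → trans (d-beyond _ (c<copy₂ a)) (degIn-copy₂ a a<n)))
                                            (C₃.pairs-copy d (λ a a<n → trans (d-beyond _ (c<copy₃ a)) (degIn-copy₃ a a<n))))))))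

lit< : ∀ m n → {T (m <ᵇ n)} → m < n
lit< m n {m<n} = <ᵇ⇒< m n m<n

lit≤ : ∀ m n → {T (m ≤ᵇ n)} → m ≤ n
lit≤ m n {m≤n} = ≤ᵇ⇒≤ m n m≤n

cycle4-simple : Simple 4 cycle4
cycle4-simple =
  (refl , lit< 0 4 , lit< 1 4) ∷ (refl , lit< 1 4 , lit< 2 4) ∷ (refl , lit< 2 4 , lit< 3 4) ∷ (refl , lit< 3 4 , lit< 0 4) ∷ [] ,
  (refl ∷ refl ∷ refl ∷ []) ∷ (refl ∷ refl ∷ []) ∷ (refl ∷ []) ∷ [] ∷ []

path3-simple : Simple 3 path3
path3-simple = (refl , lit< 0 3 , lit< 1 3) ∷ (refl , lit< 1 3 , lit< 2 3) ∷ [] , (refl ∷ []) ∷ [] ∷ []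

record Rooted (H : Graph) : Set where
  field
    simple   : Simple (suc (size H ∸ 1)) (edges H)
    root-deg : degIn (edges H) 0 ≡ 2

module GlueD (H : Graph) (rooted : Rooted H) =
  Glue 3 cycle4 cycle4-simple 1 2 3 (lit≤ 1 3) (lit≤ 2 3) ≤-refl H (Rooted.simple rooted)

module GlueE (H : Graph) (rooted : Rooted H) =
  Glue 2 path3 path3-simple 0 1 2 z≤n (lit≤ 1 2) ≤-refl H (Rooted.simple rooted)

rooted-D : ∀ k → Rooted (D (suc k))
rooted-D zero    = record { simple = cycle4-simple ; root-deg = refl }
rooted-D (suc k) = record { simple = G.simple ; root-deg = G.degIn-base 0 z≤n }
  where
  module G = GlueD (D (suc k)) (rooted-D k)

-- the degree pairs of D_{k+1} when its root has degree r
cactusPairs : ℕ → ℕ → List Edge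
cactusPairs zero    r = (r , 2) ∷ (2 , 2) ∷ (2 , 2) ∷ (2 , r) ∷ []
cactusPairs (suc k) r = (r , 4) ∷ (4 , 4) ∷ (4 , 4) ∷ (4 , r) ∷ cactusPairs k 4 ++ cactusPairs k 4 ++ cactusPairs k 4

-- In D_{k+2} the vertices b, c, d of the top 4-cycle carry a copy of D_{k+1}
-- each, so they have degree 2 + 2 = 4.
rootedPairs-D : ∀ k r → rootedPairs (D (suc k)) r ≡ cactusPairs k r
rootedPairs-D zero    r = refl
rootedPairs-D (suc k) r =
  trans (G.glue-pairs d (λ { (suc x) _ → refl }))
        (cong₂ _++_ cycle-pairs (cong₂ _++_ (copy-pairs d₁) (cong₂ _++_ (copy-pairs d₂) (copy-pairs d₃))))
  where
  module G = GlueD (D (suc k)) (rooted-D k)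
  root-deg = Rooted.root-deg (rooted-D k)
  d : ℕ → ℕ
  d = rootedDeg (D (suc (suc k))) r
  d₁ : d 1 ≡ 4
  d₁ = trans (G.degIn-base 1 (s≤s z≤n)) (cong (λ h → 2 + (h + 0)) root-deg)
  d₂ : d 2 ≡ 4
  d₂ = trans (G.degIn-base 2 (s≤s (s≤s z≤n))) (cong (λ h → 2 + (h + 0)) root-deg)
  d₃ : d 3 ≡ 4
  d₃ = trans (G.degIn-base 3 ≤-refl) (cong (2 +_) root-deg)
  cycle-pairs : degreePairs d cycle4 ≡ (r , 4) ∷ (4 , 4) ∷ (4 , 4) ∷ (4 , r) ∷ []
  cycle-pairs rewrite d₁ | d₂ | d₃ = refl
  copy-pairs : ∀ {x} → x ≡ 4 → rootedPairs (D (suc k)) x ≡ cactusPairs k 4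
  copy-pairs refl = rootedPairs-D k 4

-- the degree pairs of E_{k+2}: the path 0-1-2 gets degrees 3, 4, 3
pairsE : ℕ → List Edge
pairsE k = (3 , 4) ∷ (4 , 3) ∷ cactusPairs k 3 ++ cactusPairs k 4 ++ cactusPairs k 3

m-E : ∀ k i j → m (E (suc (suc k))) i j ≡ count (joins i j) (pairsE k)
m-E k i j = trans (m≡count-types _ i j G.simple) (cong (count (joins i j)) pairs-E)
  where
  module G = GlueE (D (suc k)) (rooted-D k)
  root-deg = Rooted.root-deg (rooted-D k)
  d : ℕ → ℕ
  d = degIn (edges (E (suc (suc k))))
  d₀ : d 0 ≡ 3
  d₀ = trans (G.degIn-base 0 z≤n) (cong (λ h → 1 + (h + 0)) root-deg)
  d₁ : d 1 ≡ 4
  d₁ = trans (G.degIn-base 1 (s≤s z≤n)) (cong (λ h → 2 + (h + 0)) root-deg)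
  d₂ : d 2 ≡ 3
  d₂ = trans (G.degIn-base 2 ≤-refl) (cong (1 +_) root-deg)
  path-pairs : degreePairs d path3 ≡ (3 , 4) ∷ (4 , 3) ∷ []
  path-pairs rewrite d₀ | d₁ | d₂ = refl
  copy-pairs : ∀ {x y} → x ≡ y → rootedPairs (D (suc k)) x ≡ cactusPairs k y
  copy-pairs {y = y} refl = rootedPairs-D k y
  pairs-E : degreePairs d (edges (E (suc (suc k)))) ≡ pairsE k
  pairs-E = trans (G.glue-pairs d (λ _ _ → refl))
                  (cong₂ _++_ path-pairs (cong₂ _++_ (copy-pairs d₀) (cong₂ _++_ (copy-pairs d₁) (copy-pairs d₂))))

-- For i ≤ j, a degree pair is of type {i , j} exactly when
-- its sorted form (min , max) is (i , j); so m_{i,j} becomes a sum of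
-- indicators, and so does every coefficient of a polynomial.

at : ℕ → ℕ → ℕ → ℕ → ℕ
at a b i j = bit ((a ≡ᵇ i) ∧ (b ≡ᵇ j))

weight : ℕ → ℕ → Edge → ℕ
weight i j (a , b) = at (a ⊓ b) (a ⊔ b) i j

joins-weight : ∀ {i j} → i ≤ j → ∀ e → bit (joins i j e) ≡ weight i j e
joins-weight {i} {j} i≤j (a , b) with ≤-total a b
... | inj₁ a≤b rewrite m≤n⇒m⊓n≡m a≤b | m≤n⇒m⊔n≡n a≤b = cong bit (T-ext to ∨-introˡ)
  where
  -- a swapped match (a , b) = (j , i) with a ≤ b forces i = j
  to : T (joins i j (a , b)) → T ((a ≡ᵇ i) ∧ (b ≡ᵇ j))
  to t with joins-endpoints {i} {j} {a} {b} t
  ... | inj₁ (refl , refl) = ∧-intro (≡ᵇ-from {a} refl) (≡ᵇ-from {b} refl)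
  ... | inj₂ (refl , refl) with ≤-antisym i≤j a≤b
  ...   | refl = ∧-intro (≡ᵇ-from {a} refl) (≡ᵇ-from {a} refl)
... | inj₂ b≤a rewrite m≥n⇒m⊓n≡n b≤a | m≥n⇒m⊔n≡m b≤a = cong bit (T-ext to from)
  where
  to : T (joins i j (a , b)) → T ((b ≡ᵇ i) ∧ (a ≡ᵇ j))
  to t with joins-endpoints {i} {j} {a} {b} t
  ... | inj₂ (refl , refl) = ∧-intro (≡ᵇ-from {b} refl) (≡ᵇ-from {a} refl)
  ... | inj₁ (refl , refl) with ≤-antisym i≤j b≤a
  ...   | refl = ∧-intro (≡ᵇ-from {a} refl) (≡ᵇ-from {a} refl)
  from : T ((b ≡ᵇ i) ∧ (a ≡ᵇ j)) → T (joins i j (a , b))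
  from s with ≡ᵇ-to {b} (proj₁ (∧-elim s)) | ≡ᵇ-to {a} (proj₂ (∧-elim {b ≡ᵇ i} s))
  ... | refl | refl = joins-swap a b

count-joins : ∀ {i j} → i ≤ j → ∀ L → count (joins i j) L ≡ sum (map (weight i j) L)
count-joins i≤j []      = refl
count-joins {i} {j} i≤j (e ∷ L) =
  trans (if-suc (joins i j e) _) (cong₂ _+_ (joins-weight i≤j e) (count-joins i≤j L))

coeff-at : ∀ (P : Poly) i j → coeff P i j ≡ sum (map (λ mono → proj₁ mono * at (proj₁ (proj₂ mono)) (proj₂ (proj₂ mono)) i j) P)
coeff-at []                  i j = refl
coeff-at ((c , a , b) ∷ P) i j = cong₂ _+_ (if-times ((a ≡ᵇ i) ∧ (b ≡ᵇ j))) (coeff-at P i j)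
  where
  if-times : ∀ t → (if t then c else 0) ≡ c * bit t
  if-times true  = sym (*-identityʳ c)
  if-times false = sym (*-zeroʳ c)

Upper : ℕ × ℕ × ℕ → Set
Upper (c , a , b) = a ≤ b

coeff-lower : ∀ P {i j} → All Upper P → ¬ (i ≤ j) → coeff P i j ≡ 0
coeff-lower []                []          _   = refl
coeff-lower ((c , a , b) ∷ P) {i} {j} (a≤b ∷ upper) i≰j with (a ≡ᵇ i) ∧ (b ≡ᵇ j) in match
... | true  = ⊥-elim (i≰j (subst₂ _≤_ (proj₁ (isPair-to {i} {j} {a} {b} (subst T (sym match) _)))
                                      (proj₂ (isPair-to {i} {j} {a} {b} (subst T (sym match) _))) a≤b))
... | false = coeff-lower P upper i≰j

hasMPoly-upper : ∀ G P → All Upper P → (∀ i j → i ≤ j → m G i j ≡ coeff P i j) → G hasMPoly P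
hasMPoly-upper G P upper agree i j with i ≤ᵇ j in le
... | true  = agree i j (≤ᵇ⇒≤ i j (subst T (sym le) _))
... | false = sym (coeff-lower P upper (λ i≤j → T-false le (≤⇒≤ᵇ i≤j)))

module CactusWeights (i j : ℕ) where

  W : List Edge → ℕ
  W L = sum (map (weight i j) L)

  W-++ : ∀ xs ys → W (xs ++ ys) ≡ W xs + W ys
  W-++ xs ys = trans (cong sum (map-++ (weight i j) xs ys)) (sum-++ (map (weight i j) xs) _)

  W-cactus-suc : ∀ k r → W (cactusPairs (suc k) r) ≡
    weight i j (r , 4) + (at 4 4 i j + (at 4 4 i j + (weight i j (4 , r) + 3 * W (cactusPairs k 4))))
  W-cactus-suc k r = cong (λ z → weight i j (r , 4) + (at 4 4 i j + (at 4 4 i j + (weight i j (4 , r) + z))))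
    (trans (W-++ C _) (trans (cong (W C +_) (W-++ C C)) (three-times (W C))))
    where
    C = cactusPairs k 4
    three-times : ∀ w → w + (w + w) ≡ 3 * w
    three-times = solve-∀

  W-cactus : ∀ k → W (cactusPairs k 4) + 2 * at 4 4 i j ≡ 2 * (at 2 2 i j + at 2 4 i j + at 4 4 i j) * 3 ^ k
  W-cactus zero = base (at 2 2 i j) (at 2 4 i j) (at 4 4 i j)
    where
    base : ∀ x₂₂ x₂₄ x₄₄ → x₂₄ + (x₂₂ + (x₂₂ + (x₂₄ + 0))) + 2 * x₄₄ ≡ 2 * (x₂₂ + x₂₄ + x₄₄) * 1
    base = solve-∀
  W-cactus (suc k) = begin
    W (cactusPairs (suc k) 4) + 2 * x₄₄
      ≡⟨ cong (_+ 2 * x₄₄) (W-cactus-suc k 4) ⟩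
    x₄₄ + (x₄₄ + (x₄₄ + (x₄₄ + 3 * W (cactusPairs k 4)))) + 2 * x₄₄
      ≡⟨ regroup x₄₄ (W (cactusPairs k 4)) ⟩
    3 * (W (cactusPairs k 4) + 2 * x₄₄)
      ≡⟨ cong (3 *_) (W-cactus k) ⟩
    3 * (2 * s * 3 ^ k)
      ≡⟨ reassociate s (3 ^ k) ⟩
    2 * s * 3 ^ suc k ∎
    where
    open ≡-Reasoning
    x₄₄ = at 4 4 i j
    s = at 2 2 i j + at 2 4 i j + at 4 4 i j
    regroup : ∀ x w → x + (x + (x + (x + 3 * w))) + 2 * x ≡ 3 * (w + 2 * x)
    regroup = solve-∀
    reassociate : ∀ s t → 3 * (2 * s * t) ≡ 2 * s * (3 * t)
    reassociate = solve-∀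

  W-pairsE : ∀ k → W (pairsE (suc k)) ≡ 6 * at 3 4 i j + 8 * at 4 4 i j + 9 * W (cactusPairs k 4)
  W-pairsE k = begin
    W (pairsE (suc k))
      ≡⟨ cong (λ z → x₃₄ + (x₃₄ + z)) (trans (W-++ C₃ _) (cong (W C₃ +_) (W-++ C₄ C₃))) ⟩
    x₃₄ + (x₃₄ + (W C₃ + (W C₄ + W C₃)))
      ≡⟨ cong (λ z → x₃₄ + (x₃₄ + z)) (cong₂ _+_ (W-cactus-suc k 3) (cong₂ _+_ (W-cactus-suc k 4) (W-cactus-suc k 3))) ⟩
    x₃₄ + (x₃₄ + (copy x₃₄ + (copy x₄₄ + copy x₃₄)))
      ≡⟨ regroup x₃₄ x₄₄ (W (cactusPairs k 4)) ⟩
    6 * x₃₄ + 8 * x₄₄ + 9 * W (cactusPairs k 4) ∎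
    where
    open ≡-Reasoning
    x₃₄ = at 3 4 i j
    x₄₄ = at 4 4 i j
    C₃ = cactusPairs (suc k) 3
    C₄ = cactusPairs (suc k) 4
    copy : ℕ → ℕ
    copy x = x + (x₄₄ + (x₄₄ + (x + 3 * W (cactusPairs k 4))))
    regroup : ∀ x y w → x + (x + ((x + (y + (y + (x + 3 * w)))) + ((y + (y + (y + (y + 3 * w)))) + (x + (y + (y + (x + 3 * w)))))))
                        ≡ 6 * x + 8 * y + 9 * w
    regroup = solve-∀

-- The final count: with A = 2·3^{k+2}, the weights 6x₃₄ + 8x₄₄ + 9W equal
-- A·(x₂₂ + x₂₄ + x₄₄) − 10x₄₄ + 6x₃₄, i.e. the {4,4} coefficient is A − 10;
-- A ≥ 10 makes the truncated subtraction exact.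
coefficient-arithmetic : ∀ A x₂₂ x₂₄ x₃₄ x₄₄ W → 10 ≤ A → 9 * (W + 2 * x₄₄) ≡ A * (x₂₂ + x₂₄ + x₄₄) →
  6 * x₃₄ + 8 * x₄₄ + 9 * W ≡ A * x₂₂ + (A * x₂₄ + (6 * x₃₄ + ((A ∸ 10) * x₄₄ + 0)))
coefficient-arithmetic A x₂₂ x₂₄ x₃₄ x₄₄ W 10≤A total = +-cancelʳ-≡ (10 * x₄₄) _ _ (begin
  6 * x₃₄ + 8 * x₄₄ + 9 * W + 10 * x₄₄
    ≡⟨ regroup₁ x₃₄ x₄₄ W ⟩
  6 * x₃₄ + 9 * (W + 2 * x₄₄)
    ≡⟨ cong (6 * x₃₄ +_) total ⟩
  6 * x₃₄ + A * (x₂₂ + x₂₄ + x₄₄)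
    ≡⟨ regroup₂ A x₂₂ x₂₄ x₃₄ x₄₄ ⟩
  A * x₂₂ + (A * x₂₄ + (6 * x₃₄ + A * x₄₄))
    ≡⟨ cong (λ z → A * x₂₂ + (A * x₂₄ + (6 * x₃₄ + z))) (sym truncation) ⟩
  A * x₂₂ + (A * x₂₄ + (6 * x₃₄ + ((A ∸ 10) * x₄₄ + 10 * x₄₄)))
    ≡⟨ regroup₃ (A * x₂₂) (A * x₂₄) x₃₄ ((A ∸ 10) * x₄₄) (10 * x₄₄) ⟩
  A * x₂₂ + (A * x₂₄ + (6 * x₃₄ + ((A ∸ 10) * x₄₄ + 0))) + 10 * x₄₄ ∎)
  where
  open ≡-Reasoning
  truncation : (A ∸ 10) * x₄₄ + 10 * x₄₄ ≡ A * x₄₄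
  truncation = trans (sym (*-distribʳ-+ x₄₄ (A ∸ 10) 10)) (cong (_* x₄₄) (m∸n+n≡m 10≤A))
  regroup₁ : ∀ x y w → 6 * x + 8 * y + 9 * w + 10 * y ≡ 6 * x + 9 * (w + 2 * y)
  regroup₁ = solve-∀
  regroup₂ : ∀ a p q x r → 6 * x + a * (p + q + r) ≡ a * p + (a * q + (6 * x + a * r))
  regroup₂ = solve-∀
  regroup₃ : ∀ p q x u v → p + (q + (6 * x + (u + v))) ≡ p + (q + (6 * x + (u + 0))) + v
  regroup₃ = solve-∀

M₁ : Poly
M₁ = (2 , 1 , 2) ∷ []

M₂ : Poly
M₂ = (6 , 2 , 2) ∷ (4 , 2 , 3) ∷ (2 , 2 , 4) ∷ (2 , 3 , 4) ∷ []

Mₙ : ℕ → Poly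
Mₙ n = (2 * 3 ^ (n ∸ 1) , 2 , 2) ∷ (2 * 3 ^ (n ∸ 1) , 2 , 4) ∷ (6 , 3 , 4) ∷ (2 * 3 ^ (n ∸ 1) ∸ 10 , 4 , 4) ∷ []

coefficients-E₁ : ∀ i j → i ≤ j → m (E 1) i j ≡ coeff M₁ i j
coefficients-E₁ i j i≤j =
  trans (m≡count-types (E 1) i j path3-simple)
  (trans (count-joins i≤j ((1 , 2) ∷ (2 , 1) ∷ []))
  (trans (regroup (at 1 2 i j)) (sym (coeff-at M₁ i j))))
  where
  regroup : ∀ x → x + (x + 0) ≡ 2 * x + 0
  regroup = solve-∀

coefficients-E₂ : ∀ i j → i ≤ j → m (E 2) i j ≡ coeff M₂ i j
coefficients-E₂ i j i≤j =
  trans (m-E 0 i j)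
  (trans (count-joins i≤j (pairsE 0))
  (trans (regroup (at 2 2 i j) (at 2 3 i j) (at 2 4 i j) (at 3 4 i j)) (sym (coeff-at M₂ i j))))
  where
  -- the weights of pairsE 0, in list order
  regroup : ∀ a b c d → d + (d + (b + (a + (a + (b + (c + (a + (a + (c + (b + (a + (a + (b + 0)))))))))))))
                        ≡ 6 * a + (4 * b + (2 * c + (2 * d + 0)))
  regroup = solve-∀

ten≤ : ∀ k → 10 ≤ 2 * 3 ^ (2 + k)
ten≤ k = ≤-trans (lit≤ 10 18) (≤-trans (*-monoʳ-≤ 18 (m^n>0 3 k)) (≤-reflexive (reassociate (3 ^ k))))
  where
  reassociate : ∀ t → 18 * t ≡ 2 * (3 * (3 * t))
  reassociate = solve-∀

coefficients-Eₙ : ∀ k i j → i ≤ j → m (E (3 + k)) i j ≡ coeff (Mₙ (3 + k)) i j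
coefficients-Eₙ k i j i≤j =
  trans (m-E (suc k) i j)
  (trans (count-joins i≤j (pairsE (suc k)))
  (trans (W-pairsE k)
  (trans (coefficient-arithmetic (2 * 3 ^ (2 + k)) (at 2 2 i j) (at 2 4 i j) (at 3 4 i j) (at 4 4 i j) (W (cactusPairs k 4)) (ten≤ k) total)
  (sym (coeff-at (Mₙ (3 + k)) i j)))))
  where
  open CactusWeights i j
  total : 9 * (W (cactusPairs k 4) + 2 * at 4 4 i j) ≡ 2 * 3 ^ (2 + k) * (at 2 2 i j + at 2 4 i j + at 4 4 i j)
  total = trans (cong (9 *_) (W-cactus k)) (reassociate (at 2 2 i j + at 2 4 i j + at 4 4 i j) (3 ^ k))
    where
    reassociate : ∀ s t → 9 * (2 * s * t) ≡ 2 * (3 * (3 * t)) * s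
    reassociate = solve-∀

theorem3p3 :
    (E 1 hasMPoly ((2 , 1 , 2) ∷ []))
    × (E 2 hasMPoly ((6 , 2 , 2) ∷ (4 , 2 , 3) ∷ (2 , 2 , 4) ∷ (2 , 3 , 4) ∷ []))
    × (∀ (n : ℕ) → 3 ≤ n →
         E n hasMPoly ((2 * 3 ^ (n ∸ 1) , 2 , 2) ∷ (2 * 3 ^ (n ∸ 1) , 2 , 4)
                       ∷ (6 , 3 , 4) ∷ (2 * 3 ^ (n ∸ 1) ∸ 10 , 4 , 4) ∷ []))
theorem3p3 =
    hasMPoly-upper (E 1) M₁ (lit≤ 1 2 ∷ []) coefficients-E₁
  , hasMPoly-upper (E 2) M₂ (lit≤ 2 2 ∷ lit≤ 2 3 ∷ lit≤ 2 4 ∷ lit≤ 3 4 ∷ []) coefficients-E₂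
  , large
  where
  large : ∀ n → 3 ≤ n → E n hasMPoly Mₙ n
  large (suc (suc (suc k))) (s≤s (s≤s (s≤s _))) =
    hasMPoly-upper (E (3 + k)) (Mₙ (3 + k)) (lit≤ 2 2 ∷ lit≤ 2 4 ∷ lit≤ 3 4 ∷ lit≤ 4 4 ∷ []) (coefficients-Eₙ k)
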